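{- Fix an integer $t \geq 2$ and positive integers $r_1,\dots,r_t$. If $n \geq R(r_1 K_2,\dots,r_t K_2)$, then $$\tilde{R}(r_1 K_2,\dots,r_t K_2;n) \geq 3\Big(\sum_{i=1}^{t} r_i - t + 1\Big) - n.$$
   Context: For graphs $G_1,\dots,G_t$, the Ramsey number $R(G_1,\dots,G_t)$ is the smallest integer $n$ such that every colouring of the edges of $K_n$ with colours $1,\dots,t$ contains, for some $i\in\{1,\dots,t\}$, a copy of $G_i$ all of whose edges have colour $i$. Here $rK_2$ denotes the matching consisting of $r$ disjoint edges. For $n \geq R(G_1,\dots,G_t)$, the restricted online Ramsey number $\tilde{R}(G_1,\dots,G_t;n)$ is the smallest integer $k$ such that Builder can always guarantee a win within the first $k$ moves of the following game between Builder and Painter: the edges of $K_n$ are initially uncoloured; in each move Builder picks an uncoloured edge of $K_n$ and Painter colours it with one of the colours $1,\dots,t$ of her choice; Builder wins as soon as, for some $i$, there is a copy of $G_i$ all of whose edges have colour $i$. -}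

module Defs where

open import Data.Nat using (ℕ; zero; suc; _≤_)
open import Data.Fin using (Fin) renaming (_<_ to _<ᶠ_)
open import Data.List using (List; []; _∷_; length; map; allFin)
open import Data.Nat.ListAction using (sum)
open import Data.List.Relation.Unary.All using (All)
open import Data.List.Relation.Unary.AllPairs using (AllPairs)
open import Data.List.Membership.Propositional using (_∈_)
open import Data.Product using (_×_; _,_; ∃-syntax; Σ-syntax)
open import Relation.Binary.PropositionalEquality using (_≡_; _≢_)
open import Relation.Nullary using (¬_)

-- An edge of K_n is a pair (u , v) of vertices with u < v (canonical
-- representative of the unordered pair {u , v}).
Pair : ℕ → Set
Pair n = Fin n × Fin n

IsEdge : ∀ {n} → Pair n → Set
IsEdge (u , v) = u <ᶠ v

Disjoint : ∀ {n} → Pair n → Pair n → Set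
Disjoint (a , b) (c , d) = a ≢ c × a ≢ d × b ≢ c × b ≢ d

HasMonoMatching : ∀ {n t} → (Pair n → Fin t → Set) → Fin t → ℕ → Set
HasMonoMatching {n} coloured c r =
  ∃[ M ] (length M ≡ r
         × All (λ e → IsEdge e × coloured e c) M
         × AllPairs Disjoint M)

-- Every t-colouring of the edges of K_m contains, for some i, a copy of
-- r_i K_2 in colour i.  (A colouring is χ : Fin m → Fin m → Fin t, the edge
-- {u,v} with u < v receiving colour χ u v.)
RamseyProperty : (t : ℕ) → (Fin t → ℕ) → ℕ → Set
RamseyProperty t r m =
  (χ : Fin m → Fin m → Fin t) →
  ∃[ i ] HasMonoMatching (λ e c → χ (Data.Product.proj₁ e) (Data.Product.proj₂ e) ≡ c) i (r i)

-- n ≥ R(r_1 K_2, …, r_t K_2), R being the least m with the Ramsey property.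
AtLeastRamsey : (t : ℕ) → (Fin t → ℕ) → ℕ → Set
AtLeastRamsey t r n = ∃[ m ] (m ≤ n × RamseyProperty t r m)

History : ℕ → ℕ → Set
History n t = List (Pair n × Fin t)

Won : ∀ {n t} → (Fin t → ℕ) → History n t → Set
Won {n} {t} r h = ∃[ i ] HasMonoMatching (λ e c → (e , c) ∈ h) i (r i)

data BuilderWins {n t : ℕ} (r : Fin t → ℕ) : History n t → ℕ → Set where
  done : ∀ {h k} → Won r h → BuilderWins r h k
  move : ∀ {h k} (e : Pair n) → IsEdge e →
         (∀ c → ¬ ((e , c) ∈ h)) →
         (∀ c → BuilderWins r ((e , c) ∷ h) k) →
         BuilderWins r h (suc k)

sumR : (t : ℕ) → (Fin t → ℕ) → ℕ
sumR t r = sum (map r (allFin t))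

-- Painter labels every vertex free, centre c (covering all c-edges at it), or root c w / leaf c v
-- (the ends of a pending c-edge vw); the tokens of colour i are its centres and roots, and she keeps
-- at most r_i − 1 of them.  An edge at a centre receives its colour.  An edge at an end of a pending
-- c-edge receives c, that end becomes a centre and the other end becomes free again.  An edge
-- between free vertices becomes a pending edge in a colour i with fewer than r_i − 1 tokens.  Every
-- i-edge then has an endpoint holding an i-token, and disjoint edges need distinct ones, so no i-coloured
-- r_i K_2 ever appears.  The weight 3·#tokens + #free starts at n, grows by at most one per move, and
-- is at least 3(Σ r_i − t) + 2 whenever Painter has no colour for a new pending edge; hence Builder
-- needs at least 3(Σ r_i − t + 1) − n moves.

module Submission where

open import Defs
open import Data.Nat using (ℕ; _≤_; _+_; _*_; _∸_)
open import Data.Fin using (Fin)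
open import Data.List using ([])

open import Data.Nat using (zero; suc; z≤n; z<s; _<_; _<?_)
open import Data.Nat.Properties hiding (_≟_)
import Data.Nat.ListAction as ListAction
open import Data.Fin using (zero; suc; _≟_; punchIn; punchOut)
open import Data.Fin.Properties using (punchInᵢ≢i; punchIn-punchOut; any?)
  renaming (<⇒≢ to <ᶠ⇒≢)
open import Data.Vec.Functional using (Vector; updateAt; removeAt)
open import Data.Vec.Functional.Properties using (updateAt-updates; updateAt-minimal)
open import Algebra.Properties.CommutativeSemigroup +-commutativeSemigroup
  using (xy∙z≈xz∙y; xy∙z≈zy∙x; xy∙z≈x∙zy; x∙yz≈xz∙y)
open import Algebra.Properties.Semiring.Sum +-*-semiring
  using (sum; sum-syntax; sum-remove; sum-cong-≗; sum-replicate-zero;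
         ∑-comm; ∑-distrib-+; *-distribˡ-sum)
open import Data.List using (List; _∷_; length; tabulate)
open import Data.List.Properties using (map-tabulate)
open import Data.List.Relation.Unary.All as All using (All; []; _∷_)
open import Data.List.Relation.Unary.AllPairs using (AllPairs; []; _∷_)
open import Data.List.Relation.Unary.Any using (here; there)
open import Data.List.Membership.Propositional using (_∈_)
open import Data.Product using (_×_; _,_; proj₁; ∃-syntax)
open import Data.Sum using (_⊎_; inj₁; inj₂; swap)
open import Data.Maybe using (Maybe; just; nothing)
open import Data.Empty using (⊥; ⊥-elim)
open import Function using (_∘_; const; id)
open import Relation.Nullary using (¬_; Dec; yes; no; contradiction)
open import Relation.Binary.PropositionalEquality

∑-mono-≤ : ∀ {n} {f g : Fin n → ℕ} → (∀ x → f x ≤ g x) → sum f ≤ sum g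
∑-mono-≤ {zero} f≤g = z≤n
∑-mono-≤ {suc n} f≤g = +-mono-≤ (f≤g zero) (∑-mono-≤ (f≤g ∘ suc))

∑-const : ∀ n k → ∑[ i < n ] k ≡ n * k
∑-const zero k = refl
∑-const (suc n) k = cong (k +_) (∑-const n k)

term≤sum : ∀ {n} (f : Fin n → ℕ) x → f x ≤ sum f
term≤sum {suc n} f x = subst (f x ≤_) (sym (sum-remove f)) (m≤m+n (f x) _)

two-terms≤sum : ∀ {n} (f : Fin n → ℕ) {x y} → x ≢ y → f x + f y ≤ sum f
two-terms≤sum {suc n} f {x} {y} x≢y = begin
  f x + f y                             ≡⟨ cong (λ z → f x + f z) (punchIn-punchOut x≢y) ⟨
  f x + removeAt f x (punchOut x≢y)     ≤⟨ +-monoʳ-≤ (f x) (term≤sum (removeAt f x) _) ⟩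
  f x + sum (removeAt f x)              ≡⟨ sum-remove f ⟨
  sum f                                 ∎
  where open ≤-Reasoning

∑-updateAt : ∀ {A : Set} {n} (F : A → ℕ) (v : Vector A n) x (f : A → A) →
             sum (F ∘ updateAt v x f) + F (v x) ≡ sum (F ∘ v) + F (f (v x))
∑-updateAt {n = suc n} F v x f = begin
  sum (F ∘ v′) + F (v x)                            ≡⟨ cong (_+ F (v x)) (sum-remove (F ∘ v′)) ⟩
  F (v′ x) + sum (removeAt (F ∘ v′) x) + F (v x)
    ≡⟨ cong₂ (λ a s → a + s + F (v x)) (cong F (updateAt-updates x v)) rest ⟩
  F (f (v x)) + sum (removeAt (F ∘ v) x) + F (v x)  ≡⟨ xy∙z≈zy∙x (F (f (v x))) _ (F (v x)) ⟩
  F (v x) + sum (removeAt (F ∘ v) x) + F (f (v x))  ≡⟨ cong (_+ F (f (v x))) (sum-remove (F ∘ v)) ⟨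
  sum (F ∘ v) + F (f (v x))                         ∎
  where
  open ≡-Reasoning
  v′ = updateAt v x f
  rest : sum (removeAt (F ∘ v′) x) ≡ sum (removeAt (F ∘ v) x)
  rest = sum-cong-≗ (λ j → cong F (updateAt-minimal (punchIn x j) x v (punchInᵢ≢i x j)))

Marked : ∀ {n} → (Fin n → ℕ) → Pair n → Set
Marked h (u , v) = 1 ≤ h u ⊎ 1 ≤ h v

Avoids : ∀ {n} → Fin n → Pair n → Set
Avoids x (u , v) = x ≢ u × x ≢ v

marked-vertex : ∀ {n} {h : Fin n → ℕ} {u v} {M : List (Pair n)} →
                Marked h (u , v) → All (Disjoint (u , v)) M →
                ∃[ x ] (1 ≤ h x × All (Avoids x) M)
marked-vertex (inj₁ hu) disj = _ , hu , All.map (λ (u≢a , u≢b , _) → u≢a , u≢b) disj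
marked-vertex (inj₂ hv) disj = _ , hv , All.map (λ (_ , _ , v≢a , v≢b) → v≢a , v≢b) disj

marked-after-clearing : ∀ {n} (h : Fin n → ℕ) {x} e → Avoids x e → Marked h e →
                        Marked (updateAt h x (const 0)) e
marked-after-clearing h (u , v) (x≢u , _) (inj₁ hu) =
  inj₁ (subst (1 ≤_) (sym (updateAt-minimal u _ h (x≢u ∘ sym))) hu)
marked-after-clearing h (u , v) (_ , x≢v) (inj₂ hv) =
  inj₂ (subst (1 ≤_) (sym (updateAt-minimal v _ h (x≢v ∘ sym))) hv)

disjoint-marked-length≤sum : ∀ {n} (h : Fin n → ℕ) (M : List (Pair n)) →
                       AllPairs Disjoint M → All (Marked h) M → length M ≤ sum h
disjoint-marked-length≤sum h [] _ _ = z≤n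
disjoint-marked-length≤sum h (e ∷ M) (disj ∷ disjs) (mark ∷ marks) = clear (marked-vertex mark disj)
  where
  clear : ∃[ x ] (1 ≤ h x × All (Avoids x) M) → suc (length M) ≤ sum h
  clear (x , hx , avoid) = begin
    1 + length M          ≤⟨ +-mono-≤ hx (disjoint-marked-length≤sum h′ M disjs marks′) ⟩
    h x + sum h′          ≡⟨ +-comm (h x) _ ⟩
    sum h′ + h x          ≡⟨ ∑-updateAt id h x (const 0) ⟩
    sum h + 0             ≡⟨ +-identityʳ _ ⟩
    sum h                 ∎
    where
    open ≤-Reasoning
    h′ = updateAt h x (const 0)
    marks′ : All (Marked h′) M
    marks′ = All.zipWith (λ (av , mk) → marked-after-clearing h _ av mk) (avoid , marks)

relabel : ∀ {A : Set} {n} → Vector A n → Fin n → A → Fin n → A → Vector A n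
relabel v x a y b = updateAt (updateAt v y (const b)) x (const a)

module _ {A : Set} {n} (v : Vector A n) {x y : Fin n} (a b : A) where

  relabel-at₁ : relabel v x a y b x ≡ a
  relabel-at₁ = updateAt-updates x _

  relabel-at₂ : x ≢ y → relabel v x a y b y ≡ b
  relabel-at₂ x≢y = trans (updateAt-minimal y x _ (x≢y ∘ sym)) (updateAt-updates y v)

  relabel-elsewhere : ∀ {z} → z ≢ x → z ≢ y → relabel v x a y b z ≡ v z
  relabel-elsewhere {z} z≢x z≢y = trans (updateAt-minimal z x _ z≢x) (updateAt-minimal z y v z≢y)

  ∑-relabel : (F : A → ℕ) {d : ℕ} → x ≢ y → F a + F b ≡ F (v x) + F (v y) + d →
              sum (F ∘ relabel v x a y b) ≡ sum (F ∘ v) + d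
  ∑-relabel F {d} x≢y new≡old+d = +-cancelʳ-≡ (F (v x) + F (v y)) _ _ (begin
    sum (F ∘ v₂) + (F (v x) + F (v y))      ≡⟨ +-assoc (sum (F ∘ v₂)) _ _ ⟨
    sum (F ∘ v₂) + F (v x) + F (v y)
      ≡⟨ cong (λ l → sum (F ∘ v₂) + F l + F (v y)) (updateAt-minimal x y v x≢y) ⟨
    sum (F ∘ v₂) + F (v₁ x) + F (v y)       ≡⟨ cong (_+ F (v y)) (∑-updateAt F v₁ x (const a)) ⟩
    sum (F ∘ v₁) + F a + F (v y)            ≡⟨ xy∙z≈xz∙y (sum (F ∘ v₁)) _ _ ⟩
    sum (F ∘ v₁) + F (v y) + F a            ≡⟨ cong (_+ F a) (∑-updateAt F v y (const b)) ⟩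
    sum (F ∘ v) + F b + F a                 ≡⟨ xy∙z≈x∙zy (sum (F ∘ v)) _ _ ⟩
    sum (F ∘ v) + (F a + F b)               ≡⟨ cong (sum (F ∘ v) +_) new≡old+d ⟩
    sum (F ∘ v) + (F (v x) + F (v y) + d)   ≡⟨ x∙yz≈xz∙y (sum (F ∘ v)) _ d ⟩
    sum (F ∘ v) + d + (F (v x) + F (v y))   ∎)
    where
    open ≡-Reasoning
    v₁ = updateAt v y (const b)
    v₂ = updateAt v₁ x (const a)

module Painter {n t : ℕ} (r : Fin t → ℕ) where

  data Label : Set where
    free   : Label
    centre : Fin t → Label
    root   : Fin t → Fin n → Label
    leaf   : Fin t → Fin n → Label

  State : Set
  State = Vector Label n

  indicator : Fin t → Fin t → ℕ
  indicator c = updateAt (const 0) c (const 1)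

  indicator-diag : ∀ c → indicator c c ≡ 1
  indicator-diag c = updateAt-updates c (const 0)

  indicator-off : ∀ {c i} → i ≢ c → indicator c i ≡ 0
  indicator-off {c} {i} i≢c = updateAt-minimal i c (const 0) i≢c

  ∑-indicator : ∀ c → sum (indicator c) ≡ 1
  ∑-indicator c = begin
    sum (indicator c)          ≡⟨ +-identityʳ _ ⟨
    sum (indicator c) + 0      ≡⟨ ∑-updateAt id (λ _ → 0) c (const 1) ⟩
    ∑[ i < t ] 0 + 1           ≡⟨ cong (_+ 1) (sum-replicate-zero t) ⟩
    1                          ∎
    where open ≡-Reasoning

  token : Fin t → Label → ℕ
  token i (centre c) = indicator c i
  token i (root c _) = indicator c i
  token i _          = 0

  tokens : Fin t → State → ℕ
  tokens i st = ∑[ x < n ] token i (st x)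

  isFree : Label → ℕ
  isFree free = 1
  isFree _    = 0

  weight : Label → ℕ
  weight free       = 1
  weight (centre _) = 3
  weight (root _ _) = 3
  weight (leaf _ _) = 0

  potential : State → ℕ
  potential st = ∑[ x < n ] weight (st x)

  weight-split : ∀ ℓ → weight ℓ ≡ 3 * ∑[ i < t ] token i ℓ + isFree ℓ
  weight-split free       = cong (λ s → 3 * s + 1) (sym (sum-replicate-zero t))
  weight-split (centre c) = cong (λ s → 3 * s + 0) (sym (∑-indicator c))
  weight-split (root c _) = cong (λ s → 3 * s + 0) (sym (∑-indicator c))
  weight-split (leaf _ _) = cong (λ s → 3 * s + 0) (sym (sum-replicate-zero t))

  freeCount : State → ℕ
  freeCount st = ∑[ x < n ] isFree (st x)

  potential-split : ∀ st → potential st ≡ 3 * ∑[ i < t ] tokens i st + freeCount st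
  potential-split st = begin
    potential st                                ≡⟨ sum-cong-≗ (weight-split ∘ st) ⟩
    ∑[ x < n ] (3 * held x + isFree (st x))     ≡⟨ ∑-distrib-+ (λ x → 3 * held x) (isFree ∘ st) ⟩
    ∑[ x < n ] (3 * held x) + freeCount st      ≡⟨ cong (_+ freeCount st) (*-distribˡ-sum 3 held) ⟨
    3 * sum held + freeCount st
      ≡⟨ cong (λ s → 3 * s + freeCount st) (∑-comm (λ x i → token i (st x))) ⟩
    3 * ∑[ i < t ] tokens i st + freeCount st   ∎
    where
    open ≡-Reasoning
    held : Fin n → ℕ
    held x = ∑[ i < t ] token i (st x)

  potential-when-exhausted : ∀ st {p q} → p ≢ q → st p ≡ free → st q ≡ free →
              (∀ i → r i ≤ tokens i st + 1) → 3 * (sum r ∸ t) + 2 ≤ potential st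
  potential-when-exhausted st {p} {q} p≢q p-free q-free full = begin
    3 * (sum r ∸ t) + 2                         ≤⟨ +-mono-≤ (*-monoʳ-≤ 3 enough-tokens) two-free ⟩
    3 * ∑[ i < t ] tokens i st + freeCount st   ≡⟨ potential-split st ⟨
    potential st                                ∎
    where
    open ≤-Reasoning
    enough-tokens : sum r ∸ t ≤ ∑[ i < t ] tokens i st
    enough-tokens = m≤n+o⇒m∸n≤o (sum r) t (begin
      sum r                               ≤⟨ ∑-mono-≤ full ⟩
      ∑[ i < t ] (tokens i st + 1)        ≡⟨ ∑-distrib-+ (λ i → tokens i st) (λ _ → 1) ⟩
      ∑[ i < t ] tokens i st + ∑[ i < t ] 1
        ≡⟨ cong (∑[ i < t ] tokens i st +_) (trans (∑-const t 1) (*-identityʳ t)) ⟩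
      ∑[ i < t ] tokens i st + t          ≡⟨ +-comm _ t ⟩
      t + ∑[ i < t ] tokens i st          ∎)
    two-free : 2 ≤ freeCount st
    two-free = subst (_≤ freeCount st) (cong₂ (λ a b → isFree a + isFree b) p-free q-free)
                     (two-terms≤sum (isFree ∘ st) p≢q)

  Covers : Label → Fin t → Fin n → Set
  Covers (centre c) i _ = c ≡ i
  Covers (root c w) i y = c ≡ i × w ≡ y
  Covers _          _ _ = ⊥

  Covered : State → Pair n → Fin t → Set
  Covered st (a , b) i = Covers (st a) i b ⊎ Covers (st b) i a

  Preserves : State → State → Set
  Preserves st st′ = ∀ {a i b} → Covers (st a) i b → Covered st′ (a , b) i

  preserves-covered : ∀ {st st′} → Preserves st st′ → ∀ {e i} → Covered st e i → Covered st′ e i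
  preserves-covered pres (inj₁ cov) = pres cov
  preserves-covered pres (inj₂ cov) = swap (pres cov)

  relabel-preserves : ∀ {st p w ℓ ℓ′} → p ≢ w →
                      (∀ {i b} → Covers (st p) i b → Covered (relabel st p ℓ w ℓ′) (p , b) i) →
                      (∀ {i b} → Covers (st w) i b → Covered (relabel st p ℓ w ℓ′) (w , b) i) →
                      Preserves st (relabel st p ℓ w ℓ′)
  relabel-preserves {st} {p} {w} {ℓ} {ℓ′} p≢w from-p from-w {a} {i} {b} cov =
    by-position (a ≟ p) (a ≟ w)
    where
    by-position : Dec (a ≡ p) → Dec (a ≡ w) → Covered (relabel st p ℓ w ℓ′) (a , b) i
    by-position (yes refl) _          = from-p cov
    by-position (no _)     (yes refl) = from-w cov
    by-position (no a≢p)   (no a≢w)   =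
      inj₁ (subst (λ l → Covers l i b) (sym (relabel-elsewhere st ℓ ℓ′ a≢p a≢w)) cov)

  partner : Label → Maybe (Fin n)
  partner (root _ y) = just y
  partner (leaf _ y) = just y
  partner _          = nothing

  mate : Label → Fin n → Label
  mate (root c _) x = leaf c x
  mate (leaf c _) x = root c x
  mate ℓ          _ = ℓ

  partner-mate : ∀ ℓ {x y} → partner ℓ ≡ just y → partner (mate ℓ x) ≡ just x
  partner-mate (root _ _) _ = refl
  partner-mate (leaf _ _) _ = refl

  Pairing : State → Set
  Pairing st = ∀ {x y} → partner (st x) ≡ just y → st y ≡ mate (st x) x

  PairedOn : Label → Fin n → Label → Fin n → Set
  PairedOn ℓ p ℓ′ w = (∀ {y} → partner ℓ ≡ just y → y ≡ w × ℓ′ ≡ mate ℓ p) ×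
                      (∀ {y} → partner ℓ′ ≡ just y → y ≡ p × ℓ ≡ mate ℓ′ w)

  pending-paired : ∀ {c p w} → PairedOn (root c w) p (leaf c p) w
  pending-paired = (λ { refl → refl , refl }) , (λ { refl → refl , refl })

  mate-at : ∀ {st x y ℓ} → Pairing st → st x ≡ ℓ → partner ℓ ≡ just y → st y ≡ mate ℓ x
  mate-at pairing refl has-partner = pairing has-partner

  relabel-pairing : ∀ {st p w ℓ ℓ′} → Pairing st → p ≢ w →
                    PairedOn (st p) p (st w) w → PairedOn ℓ p ℓ′ w →
                    Pairing (relabel st p ℓ w ℓ′)
  relabel-pairing {st} {p} {w} {ℓ} {ℓ′} pairing p≢w (old-p , old-w) (new-p , new-w) {x} {y} =
    by-position (x ≟ p) (x ≟ w)
    where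
    st′ = relabel st p ℓ w ℓ′
    at₁ : st′ p ≡ ℓ
    at₁ = relabel-at₁ st ℓ ℓ′
    at₂ : st′ w ≡ ℓ′
    at₂ = relabel-at₂ st ℓ ℓ′ p≢w
    off : ∀ {z} → z ≢ p → z ≢ w → st′ z ≡ st z
    off = relabel-elsewhere st ℓ ℓ′
    partner-is : ∀ {l l′ z} → l ≡ l′ → partner l ≡ just z → partner l′ ≡ just z
    partner-is eq = subst (λ l → partner l ≡ just _) eq

    -- The old labels at p and w have their partners in {p, w}, so no vertex outside points there.
    from-outside : x ≢ p → x ≢ w → partner (st x) ≡ just y →
                   Dec (y ≡ p) → Dec (y ≡ w) → st′ y ≡ mate (st′ x) x
    from-outside x≢p x≢w e (yes refl) _ =
      contradiction (proj₁ (old-p (partner-is (sym (pairing e)) (partner-mate (st x) e)))) x≢w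
    from-outside x≢p x≢w e (no _) (yes refl) =
      contradiction (proj₁ (old-w (partner-is (sym (pairing e)) (partner-mate (st x) e)))) x≢p
    from-outside x≢p x≢w e (no y≢p) (no y≢w) =
      trans (off y≢p y≢w) (trans (pairing e) (cong (λ l → mate l x) (sym (off x≢p x≢w))))

    by-position : Dec (x ≡ p) → Dec (x ≡ w) → partner (st′ x) ≡ just y → st′ y ≡ mate (st′ x) x
    by-position (yes refl) _ e with new-p (partner-is at₁ e)
    ... | refl , ℓ′≡mate = trans at₂ (trans ℓ′≡mate (cong (λ l → mate l x) (sym at₁)))
    by-position (no _) (yes refl) e with new-w (partner-is at₂ e)
    ... | refl , ℓ≡mate = trans at₁ (trans ℓ≡mate (cong (λ l → mate l x) (sym at₂)))
    by-position (no x≢p) (no x≢w) e =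
      from-outside x≢p x≢w (partner-is (off x≢p x≢w) e) (y ≟ p) (y ≟ w)

  Budget : State → Set
  Budget st = ∀ i → tokens i st < r i

  record Invariant (st : State) : Set where
    field
      pairing : Pairing st
      budget  : Budget st

  record Successor (st st′ : State) : Set where
    field
      preserves : Preserves st st′
      invariant : Invariant st′
      potential-step : potential st′ ≤ potential st + 1

  record Response (st : State) (p q : Fin n) : Set where
    field
      colour    : Fin t
      next      : State
      covered   : Covered next (p , q) colour
      successor : Successor st next

  swap-response : ∀ {st p q} → Response st q p → Response st p q
  swap-response res = record { Response res; covered = swap (Response.covered res) }

  colour-at-centre : ∀ {st p q c} → Invariant st → st p ≡ centre c → Response st p q
  colour-at-centre {st} {p} {q} {c} inv at-p = record
    { colour    = c
    ; next      = st
    ; covered   = inj₁ (subst (λ l → Covers l c q) (sym at-p) refl)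
    ; successor = record { preserves = inj₁ ; invariant = inv ; potential-step = m≤m+n _ 1 }
    }

  PendingEdge : State → Fin t → Fin n → Fin n → Set
  PendingEdge st c u v = st u ≡ root c v × st v ≡ leaf c u

  pending-distinct : ∀ {st c u v} → PendingEdge st c u v → u ≢ v
  pending-distinct (at-u , at-v) refl with trans (sym at-u) at-v
  ... | ()

  data Resolution (c : Fin t) : Label → Label → Set where
    centre-at-root : Resolution c (centre c) free
    centre-at-leaf : Resolution c free (centre c)

  module _ {c : Fin t} {u v : Fin n} where

    resolution-paired : ∀ {ℓ ℓ′} → Resolution c ℓ ℓ′ → PairedOn ℓ u ℓ′ v
    resolution-paired centre-at-root = (λ ()) , (λ ())
    resolution-paired centre-at-leaf = (λ ()) , (λ ())

    resolution-weight : ∀ {ℓ ℓ′} → Resolution c ℓ ℓ′ →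
                        weight ℓ + weight ℓ′ ≡ weight (root c v) + weight (leaf c u) + 1
    resolution-weight centre-at-root = refl
    resolution-weight centre-at-leaf = refl

    resolution-tokens : ∀ {ℓ ℓ′} → Resolution c ℓ ℓ′ → ∀ i →
                        token i ℓ + token i ℓ′ ≡ token i (root c v) + token i (leaf c u) + 0
    resolution-tokens centre-at-root i = sym (+-identityʳ _)
    resolution-tokens centre-at-leaf i = sym (trans (+-identityʳ _) (+-identityʳ _))

    resolution-covers : ∀ {ℓ ℓ′} (st : State) → u ≢ v → Resolution c ℓ ℓ′ →
                        Covered (relabel st u ℓ v ℓ′) (u , v) c
    resolution-covers st _ centre-at-root =
      inj₁ (subst (λ l → Covers l c v) (sym (relabel-at₁ st _ _)) refl)
    resolution-covers st u≢v centre-at-leaf =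
      inj₂ (subst (λ l → Covers l c u) (sym (relabel-at₂ st _ _ u≢v)) refl)

  resolved-successor : ∀ {st c u v ℓ ℓ′} → Invariant st → PendingEdge st c u v →
                       Resolution c ℓ ℓ′ → Successor st (relabel st u ℓ v ℓ′)
  resolved-successor {st} {c} {u} {v} {ℓ} {ℓ′} inv pending@(at-u , at-v) res = record
    { preserves      = relabel-preserves u≢v from-u from-v
    ; invariant      = record
      { pairing = relabel-pairing (Invariant.pairing inv) u≢v old-paired (resolution-paired res)
      ; budget  = budget′ }
    ; potential-step = ≤-reflexive (∑-relabel st ℓ ℓ′ weight u≢v
                         (trans (resolution-weight {u = u} {v = v} res) (cong (_+ 1) (sym (old weight)))))
    }
    where
    u≢v = pending-distinct pending
    old : ∀ (F : Label → ℕ) → F (st u) + F (st v) ≡ F (root c v) + F (leaf c u)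
    old F = cong₂ (λ a b → F a + F b) at-u at-v
    old-paired : PairedOn (st u) u (st v) v
    old-paired = subst₂ (λ a b → PairedOn a u b v) (sym at-u) (sym at-v) pending-paired
    budget′ : Budget (relabel st u ℓ v ℓ′)
    budget′ i = subst (_< r i) (sym (trans unchanged (+-identityʳ _))) (Invariant.budget inv i)
      where
      unchanged = ∑-relabel st ℓ ℓ′ (token i) u≢v
                    (trans (resolution-tokens {u = u} {v = v} res i) (cong (_+ 0) (sym (old (token i)))))
    from-u : ∀ {i b} → Covers (st u) i b → Covered (relabel st u ℓ v ℓ′) (u , b) i
    from-u cov with subst (λ l → Covers l _ _) at-u cov
    ... | refl , refl = resolution-covers st u≢v res
    from-v : ∀ {i b} → Covers (st v) i b → Covered (relabel st u ℓ v ℓ′) (v , b) i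
    from-v cov = ⊥-elim (subst (λ l → Covers l _ _) at-v cov)

  resolve-at-root : ∀ {st c u v q} → Invariant st → st u ≡ root c v → Response st u q
  resolve-at-root {st} {c} {u} {v} {q} inv at-u = record
    { colour    = c
    ; next      = relabel st u (centre c) v free
    ; covered   = inj₁ (subst (λ l → Covers l c q) (sym (relabel-at₁ st _ _)) refl)
    ; successor = resolved-successor inv pending centre-at-root
    }
    where
    pending : PendingEdge st c u v
    pending = at-u , mate-at (Invariant.pairing inv) at-u refl

  resolve-at-leaf : ∀ {st c u v q} → Invariant st → st v ≡ leaf c u → Response st v q
  resolve-at-leaf {st} {c} {u} {v} {q} inv at-v = record
    { colour    = c
    ; next      = relabel st u free v (centre c)
    ; covered   = inj₁ (subst (λ l → Covers l c q) (sym (relabel-at₂ st _ _ u≢v)) refl)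
    ; successor = resolved-successor inv pending centre-at-leaf
    }
    where
    pending : PendingEdge st c u v
    pending = mate-at (Invariant.pairing inv) at-v refl , at-v
    u≢v = pending-distinct pending

  open-pending-edge : ∀ {st p q} c → Invariant st → p ≢ q → st p ≡ free → st q ≡ free →
                      tokens c st + 1 < r c → Response st p q
  open-pending-edge {st} {p} {q} c inv p≢q p-free q-free room = record
    { colour    = c
    ; next      = st′
    ; covered   = inj₁ (subst (λ l → Covers l c q) (sym (relabel-at₁ st _ _)) (refl , refl))
    ; successor = record
      { preserves      = relabel-preserves p≢q (⊥-elim ∘ was-free p-free) (⊥-elim ∘ was-free q-free)
      ; invariant      = record
        { pairing = relabel-pairing (Invariant.pairing inv) p≢q old-paired pending-paired
        ; budget  = budget′ }
      ; potential-step = ≤-reflexive (∑-relabel st _ _ weight p≢q (cong (_+ 1) (sym (old weight))))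
      }
    }
    where
    st′ = relabel st p (root c q) q (leaf c p)
    old : ∀ (F : Label → ℕ) → F (st p) + F (st q) ≡ F free + F free
    old F = cong₂ (λ a b → F a + F b) p-free q-free
    was-free : ∀ {x i b} → st x ≡ free → Covers (st x) i b → ⊥
    was-free at-x = subst (λ l → Covers l _ _) at-x
    old-paired : PairedOn (st p) p (st q) q
    old-paired = subst₂ (λ a b → PairedOn a p b q) (sym p-free) (sym q-free) ((λ ()) , (λ ()))
    gained : ∀ i → tokens i st′ ≡ tokens i st + indicator c i
    gained i = ∑-relabel st _ _ (token i) p≢q
                 (trans (+-identityʳ _) (cong (_+ indicator c i) (sym (old (token i)))))
    budget′ : Budget st′
    budget′ i with i ≟ c
    ... | yes refl = subst (_< r i) (sym (trans (gained i) (cong (tokens i st +_) (indicator-diag i)))) room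
    ... | no i≢c   = subst (_< r i) (sym unchanged) (Invariant.budget inv i)
      where
      unchanged : tokens i st′ ≡ tokens i st
      unchanged = trans (gained i) (trans (cong (tokens i st +_) (indicator-off i≢c)) (+-identityʳ _))

  respond : ∀ st → Invariant st → ∀ {p q} → p ≢ q → potential st < 3 * (sum r ∸ t) + 2 →
            Response st p q
  respond st inv {p} {q} p≢q room with st p in at-p | st q in at-q
  ... | centre c | _        = colour-at-centre inv at-p
  ... | root c w | _        = resolve-at-root inv at-p
  ... | leaf c w | _        = resolve-at-leaf inv at-p
  ... | free     | centre c = swap-response (colour-at-centre inv at-q)
  ... | free     | root c w = swap-response (resolve-at-root inv at-q)
  ... | free     | leaf c w = swap-response (resolve-at-leaf inv at-q)
  ... | free     | free with any? (λ c → tokens c st + 1 <? r c)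
  ...   | yes (c , has-room) = open-pending-edge c inv p≢q at-p at-q has-room
  ...   | no full = contradiction (potential-when-exhausted st p≢q at-p at-q no-room) (<⇒≱ room)
    where
    no-room : ∀ i → r i ≤ tokens i st + 1
    no-room i = ≮⇒≥ (λ has-room → full (i , has-room))

  allFree : State
  allFree _ = free

  allFree-invariant : (∀ i → 1 ≤ r i) → Invariant allFree
  allFree-invariant r≥1 = record
    { pairing = λ ()
    ; budget  = λ i → subst (_< r i) (sym (sum-replicate-zero n)) (r≥1 i) }

  potential-allFree : potential allFree ≡ n
  potential-allFree = trans (∑-const n 1) (*-identityʳ n)

  CoversHistory : State → History n t → Set
  CoversHistory st h = ∀ {e i} → (e , i) ∈ h → Covered st e i

  covers-token : ∀ {ℓ i y} → Covers ℓ i y → 1 ≤ token i ℓ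
  covers-token {centre c} refl       = ≤-reflexive (sym (indicator-diag c))
  covers-token {root c _} (refl , _) = ≤-reflexive (sym (indicator-diag c))

  covered-marked : ∀ {st i} e → Covered st e i → Marked (λ x → token i (st x)) e
  covered-marked (a , b) (inj₁ cov) = inj₁ (covers-token cov)
  covered-marked (a , b) (inj₂ cov) = inj₂ (covers-token cov)

  never-won : ∀ {st h} → CoversHistory st h → Budget st → ¬ Won r h
  never-won {st} covers budget (i , M , |M|≡ri , edges , disjoint) = <⇒≱ (budget i) (begin
    r i          ≡⟨ |M|≡ri ⟨
    length M     ≤⟨ disjoint-marked-length≤sum (λ x → token i (st x)) M disjoint
                      (All.map (λ {e} (_ , e∈h) → covered-marked {st} {i} e (covers e∈h)) edges) ⟩
    tokens i st  ∎)
    where open ≤-Reasoning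

  painter-survives : ∀ {h k} → BuilderWins r h k → ∀ st → Invariant st → CoversHistory st h →
                     potential st + k ≤ 3 * (sum r ∸ t) + 2 → ⊥
  painter-survives (done won) st inv covers _ = never-won covers (Invariant.budget inv) won
  painter-survives {h} {suc k} (move (u , v) u<v _ continue) st inv covers bound =
    painter-survives (continue colour) next (Successor.invariant successor) covers′ bound′
    where
    room : potential st < 3 * (sum r ∸ t) + 2
    room = <-≤-trans (m<m+n (potential st) z<s) bound
    open Response (respond st inv (<ᶠ⇒≢ u<v) room)
    covers′ : CoversHistory next (((u , v) , colour) ∷ h)
    covers′ (here refl)  = covered
    covers′ (there e∈h) = preserves-covered (Successor.preserves successor) (covers e∈h)
    bound′ : potential next + k ≤ 3 * (sum r ∸ t) + 2
    bound′ = begin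
      potential next + k      ≤⟨ +-monoˡ-≤ k (Successor.potential-step successor) ⟩
      potential st + 1 + k    ≡⟨ +-assoc (potential st) 1 k ⟩
      potential st + suc k    ≤⟨ bound ⟩
      3 * (sum r ∸ t) + 2     ∎
      where open ≤-Reasoning

sum-tabulate : ∀ {n} (f : Fin n → ℕ) → ListAction.sum (tabulate f) ≡ sum f
sum-tabulate {zero}  f = refl
sum-tabulate {suc n} f = cong (f zero +_) (sum-tabulate (f ∘ suc))

sumR≡sum : ∀ t (r : Fin t → ℕ) → sumR t r ≡ sum r
sumR≡sum t r = trans (cong ListAction.sum (map-tabulate id r)) (sum-tabulate r)

theorem3 : (t : ℕ) → 2 ≤ t → (r : Fin t → ℕ) → (∀ i → 1 ≤ r i) →
    (n : ℕ) → AtLeastRamsey t r n →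
    (k : ℕ) → BuilderWins {n} {t} r [] k →
    3 * (sumR t r ∸ t + 1) ∸ n ≤ k
theorem3 t _ r r≥1 n _ k wins = m≤n+o⇒m∸n≤o _ n (begin
  3 * (sumR t r ∸ t + 1)      ≡⟨ cong (λ s → 3 * (s ∸ t + 1)) (sumR≡sum t r) ⟩
  3 * (sum r ∸ t + 1)         ≡⟨ *-distribˡ-+ 3 (sum r ∸ t) 1 ⟩
  3 * (sum r ∸ t) + 3         ≡⟨ +-suc _ 2 ⟩
  suc (3 * (sum r ∸ t) + 2)   ≤⟨ ≰⇒> painter-wins-longer ⟩
  n + k                       ∎)
  where
  open ≤-Reasoning
  open Painter {n} r
  painter-wins-longer : ¬ (n + k ≤ 3 * (sum r ∸ t) + 2)
  painter-wins-longer bound = painter-survives wins allFree (allFree-invariant r≥1) (λ ())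
    (subst (λ s → s + k ≤ 3 * (sum r ∸ t) + 2) (sym potential-allFree) bound)
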